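{- There exists a $\sqrt[6]{1}$-matroid $\mathcal{M}$ admitting two $\mathbb{H}$-representations $M$ and $M'$ such that $\mathrm{Jac}(M)\not\cong\mathrm{Jac}(M')$ as $\mathcal{E}$-modules.
   Context: Let $\omega=e^{2\pi i/6}$, $\mathcal{E}=\mathbb{Z}[\omega]$, $\mathbb{H}=\{z\in\mathbb{C}: z^6=1\}\cup\{0\}$. A complex matrix is an $\mathbb{H}$-matrix if every square subdeterminant lies in $\mathbb{H}$. A matroid $\mathcal{M}$ on an $n$-element ground set is represented by a complex matrix $M$ (columns indexed by the ground set) if independent sets correspond to linearly independent sets of columns over $\mathbb{C}$; if $M$ is an $\mathbb{H}$-matrix, it is an $\mathbb{H}$-representation and $\mathcal{M}$ is a $\sqrt[6]{1}$-matroid. $M^{\mathrm H}$ is the conjugate transpose. Define $\Lambda^*_{\mathcal{E}}(M)=\mathrm{row}_{\mathbb{C}}(M)\cap\mathcal{E}^n$, $\Lambda_{\mathcal{E}}(M)=\{v\in\mathbb{C}^n: vM^{\mathrm H}=0\}\cap\mathcal{E}^n$ and $\mathrm{Jac}(M)=\mathcal{E}^n/(\Lambda_{\mathcal{E}}(M)\oplus\Lambda^*_{\mathcal{E}}(M))$. -}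

module Defs where

open import Data.Integer using (ℤ; +_) renaming (_+_ to _+ℤ_; _*_ to _*ℤ_; -_ to -ℤ_)
open import Data.Nat using (ℕ; zero; suc)
open import Data.Fin using (Fin; zero; suc; punchIn) renaming (_<_ to _<ᶠ_)
open import Data.Fin.Subset using (Subset; _∉_)
open import Data.Product using (Σ; _×_; _,_)
open import Data.Sum using (_⊎_)
open import Relation.Binary.PropositionalEquality using (_≡_; _≢_)

-- Eisenstein integers  a + b ω  with ω = e^{2πi/6}, so ω² = ω - 1.
record 𝓔 : Set where
  constructor mkE
  field
    re : ℤ
    im : ℤ

0E 1E ωE : 𝓔
0E = mkE (+ 0) (+ 0)
1E = mkE (+ 1) (+ 0)
ωE = mkE (+ 0) (+ 1)

infixl 6 _+E_ _-E_
infixl 7 _*E_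

_+E_ : 𝓔 → 𝓔 → 𝓔
mkE a b +E mkE c d = mkE (a +ℤ c) (b +ℤ d)

-E_ : 𝓔 → 𝓔
-E mkE a b = mkE (-ℤ a) (-ℤ b)

_-E_ : 𝓔 → 𝓔 → 𝓔
x -E y = x +E (-E y)

_*E_ : 𝓔 → 𝓔 → 𝓔
mkE a b *E mkE c d = mkE (a *ℤ c +ℤ -ℤ (b *ℤ d)) (a *ℤ d +ℤ b *ℤ c +ℤ b *ℤ d)

-- complex conjugation: conj ω = 1 - ω
conj : 𝓔 → 𝓔
conj (mkE a b) = mkE (a +ℤ b) (-ℤ b)

_^E_ : 𝓔 → ℕ → 𝓔
x ^E zero = 1E
x ^E suc k = x *E (x ^E k)

IsH : 𝓔 → Set
IsH z = (z ≡ 0E) ⊎ (z ^E 6 ≡ 1E)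

sumE : ∀ {k} → (Fin k → 𝓔) → 𝓔
sumE {zero} f = 0E
sumE {suc k} f = f zero +E sumE (λ i → f (suc i))

det : ∀ {k} → (Fin k → Fin k → 𝓔) → 𝓔
det {zero} A = 1E
det {suc k} A = sumE (λ j → sign j *E A zero j *E det (λ i l → A (suc i) (punchIn j l)))
  where
  sign : ∀ {k} → Fin k → 𝓔
  sign zero = 1E
  sign (suc j) = -E sign j

Matrix : ℕ → ℕ → Set
Matrix m n = Fin m → Fin n → 𝓔

Vec𝓔 : ℕ → Set
Vec𝓔 n = Fin n → 𝓔

StrictMono : ∀ {k m} → (Fin k → Fin m) → Set
StrictMono r = ∀ i j → i <ᶠ j → r i <ᶠ r j

IsHMatrix : ∀ {m n} → Matrix m n → Set
IsHMatrix {m} {n} M =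
  (k : ℕ) (r : Fin k → Fin m) (c : Fin k → Fin n) →
  StrictMono r → StrictMono c → IsH (det (λ i j → M (r i) (c j)))

-- the columns indexed by S are linearly independent
-- (coefficients in 𝓔; equivalent to ℂ-independence since entries lie in ℚ(ω))
IndepCols : ∀ {m n} → Matrix m n → Subset n → Set
IndepCols {m} {n} M S =
  (c : Vec𝓔 n) → (∀ j → j ∉ S → c j ≡ 0E) →
  (∀ i → sumE (λ j → c j *E M i j) ≡ 0E) → ∀ j → c j ≡ 0E

SameMatroid : ∀ {m m' n} → Matrix m n → Matrix m' n → Set
SameMatroid {n = n} M M' =
  (S : Subset n) → (IndepCols M S → IndepCols M' S) × (IndepCols M' S → IndepCols M S)

-- Λ*_𝓔(M) = row_ℂ(M) ∩ 𝓔^n : v is a ℚ(ω)-combination of rows,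
-- i.e. d v = x M for some nonzero d ∈ 𝓔 and x ∈ 𝓔^m
InΛ* : ∀ {m n} → Matrix m n → Vec𝓔 n → Set
InΛ* {m} M v = Σ 𝓔 λ d → d ≢ 0E × Σ (Vec𝓔 m) λ x → ∀ j → d *E v j ≡ sumE (λ i → x i *E M i j)

InΛ : ∀ {m n} → Matrix m n → Vec𝓔 n → Set
InΛ M v = ∀ i → sumE (λ j → v j *E conj (M i j)) ≡ 0E

InL : ∀ {m n} → Matrix m n → Vec𝓔 n → Set
InL {n = n} M v = Σ (Vec𝓔 n) λ a → Σ (Vec𝓔 n) λ b → InΛ M a × InΛ* M b × (∀ j → v j ≡ a j +E b j)

-- equality in Jac(M) = 𝓔^n / (Λ ⊕ Λ*)
JacEq : ∀ {m n} → Matrix m n → Vec𝓔 n → Vec𝓔 n → Set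
JacEq M x y = InL M (λ j → x j -E y j)

_+V_ : ∀ {n} → Vec𝓔 n → Vec𝓔 n → Vec𝓔 n
(x +V y) j = x j +E y j

_·V_ : ∀ {n} → 𝓔 → Vec𝓔 n → Vec𝓔 n
(c ·V x) j = c *E x j

-- an 𝓔-module isomorphism Jac(M) ≅ Jac(M'), maps given on representatives
record JacIso {m m' n} (M : Matrix m n) (M' : Matrix m' n) : Set where
  field
    f : Vec𝓔 n → Vec𝓔 n
    g : Vec𝓔 n → Vec𝓔 n
    f-cong : ∀ x y → JacEq M x y → JacEq M' (f x) (f y)
    f-+ : ∀ x y → JacEq M' (f (x +V y)) (f x +V f y)
    f-· : ∀ c x → JacEq M' (f (c ·V x)) (c ·V f x)
    g-cong : ∀ x y → JacEq M' x y → JacEq M (g x) (g y)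
    g-+ : ∀ x y → JacEq M (g (x +V y)) (g x +V g y)
    g-· : ∀ c x → JacEq M (g (c ·V x)) (c ·V g x)
    gf : ∀ x → JacEq M (g (f x)) x
    fg : ∀ y → JacEq M' (f (g y)) y

-- M and M' differ only in the entries ω and ω̄ of their last four columns. Every minor of either
-- matrix is 0 or a sixth root of unity, and a minor of M vanishes exactly when the corresponding
-- minor of M' does; by Cramer's rule this zero pattern decides which sets of columns are
-- independent, so M and M' represent the same matroid.
--
-- The Jacobians differ in their annihilators. As 28 (M Mᴴ)⁻¹ is integral, every w splits as
-- 28 w = a + b with a Mᴴ = 0 and b an integral combination of the rows of M, so 28 kills Jac(M).
-- For M' take the functional v ↦ ρ (v M'ᴴ Φ), where ρ : 𝓔 → ℤ/49 sends ω to 19. It vanishes on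
-- Λ(M'), and on Λ*(M') because M' has an integral right inverse (so Λ*(M') is the integral row
-- space) and ρ (M' M'ᴴ Φ) = 0. It does not vanish on 28 e₀, so 28 does not kill Jac(M'), whereas an
-- 𝓔-module isomorphism preserves annihilators.
module Submission where

open import Defs
open import Algebra.Bundles using (CommutativeRing)
import Algebra.Properties.Semiring.Sum as SemiringSum
open import Algebra.Structures using (IsCommutativeRing)
open import Data.Fin using (Fin; zero; suc; #_; _≟_; _<_)
open import Data.Fin.Properties using (all?; ¬∀⟶∃¬; _<?_)
open import Data.Fin.Subset using (Subset; _∈_; _∉_)
open import Data.Fin.Subset.Properties using (_∈?_)
open import Data.Integer using (ℤ; +_; -[1+_]; 0ℤ; ∣_∣)
  renaming (_+_ to _+ℤ_; _*_ to _*ℤ_; -_ to -ℤ_; _-_ to _-ℤ_)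
open import Data.Integer.Divisibility.Signed using (_∣_; _∣?_; divides; ∣m∣n⇒∣m+n; ∣n⇒∣m*n)
import Data.Integer.Properties as ℤ
open import Data.Integer.Tactic.RingSolver using (solve-∀)
open import Data.List using (List; []; _∷_; map; foldr; filter; allFin)
open import Data.List.Membership.Propositional using () renaming (_∈_ to _∈ₗ_; _∉_ to _∉ₗ_)
open import Data.List.Membership.Propositional.Properties using (∈-filter⁺; ∈-filter⁻; ∈-allFin)
open import Data.List.Properties using (map-cong-local)
open import Data.List.Relation.Unary.All as All using (All; []; _∷_)
open import Data.List.Relation.Unary.AllPairs using ([]; _∷_)
open import Data.List.Relation.Unary.Any using (here; there)
open import Data.List.Relation.Unary.Unique.Propositional using (Unique)
open import Data.List.Relation.Unary.Unique.Propositional.Properties using (filter⁺; allFin⁺)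
open import Data.Maybe using (Maybe; just; nothing)
open import Data.Nat using (ℕ; zero; suc; z≤n; s≤s) renaming (_+_ to _+ℕ_; _*_ to _*ℕ_)
import Data.Nat.Properties as ℕ
open import Data.Product using (Σ; ∃; ∃₂; _×_; _,_; proj₁; proj₂)
open import Data.Sum using (_⊎_; inj₁; inj₂; [_,_]; reduce)
open import Data.Sum.Properties using (inj₂-injective)
open import Data.Vec using (Vec; []; _∷_; lookup)
open import Function using (id; _∘_)
open import Relation.Binary.Definitions using (DecidableEquality)
open import Relation.Binary.PropositionalEquality
  using (_≡_; _≢_; _≗_; refl; sym; trans; cong; cong₂; subst; isEquivalence; module ≡-Reasoning)
open import Relation.Nullary using (Dec; ¬_; yes; no; contradiction)
open import Relation.Nullary.Decidable using (map′; from-yes; from-no; ¬?; _×-dec_; _⊎-dec_; _→-dec_)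
import Tactic.RingSolver as Solver
open import Tactic.RingSolver.Core.AlmostCommutativeRing using (AlmostCommutativeRing; fromCommutativeRing)

private
  variable
    k m m' n p : ℕ
    S : Subset n

-- The ring of Eisenstein integers

+E-assoc : ∀ x y z → (x +E y) +E z ≡ x +E (y +E z)
+E-assoc (mkE a b) (mkE c d) (mkE e f) = cong₂ mkE (ℤ.+-assoc a c e) (ℤ.+-assoc b d f)

+E-comm : ∀ x y → x +E y ≡ y +E x
+E-comm (mkE a b) (mkE c d) = cong₂ mkE (ℤ.+-comm a c) (ℤ.+-comm b d)

+E-identityˡ : ∀ x → 0E +E x ≡ x
+E-identityˡ (mkE a b) = cong₂ mkE (ℤ.+-identityˡ a) (ℤ.+-identityˡ b)

+E-identityʳ : ∀ x → x +E 0E ≡ x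
+E-identityʳ (mkE a b) = cong₂ mkE (ℤ.+-identityʳ a) (ℤ.+-identityʳ b)

-E-inverseˡ : ∀ x → (-E x) +E x ≡ 0E
-E-inverseˡ (mkE a b) = cong₂ mkE (ℤ.+-inverseˡ a) (ℤ.+-inverseˡ b)

-E-inverseʳ : ∀ x → x +E (-E x) ≡ 0E
-E-inverseʳ (mkE a b) = cong₂ mkE (ℤ.+-inverseʳ a) (ℤ.+-inverseʳ b)

*E-assoc : ∀ x y z → (x *E y) *E z ≡ x *E (y *E z)
*E-assoc (mkE a b) (mkE c d) (mkE e f) = cong₂ mkE (re a b c d e f) (im a b c d e f)
  where
  re : ∀ a b c d e f → (a *ℤ c +ℤ -ℤ (b *ℤ d)) *ℤ e +ℤ -ℤ ((a *ℤ d +ℤ b *ℤ c +ℤ b *ℤ d) *ℤ f)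
                     ≡ a *ℤ (c *ℤ e +ℤ -ℤ (d *ℤ f)) +ℤ -ℤ (b *ℤ (c *ℤ f +ℤ d *ℤ e +ℤ d *ℤ f))
  re = solve-∀
  im : ∀ a b c d e f → (a *ℤ c +ℤ -ℤ (b *ℤ d)) *ℤ f +ℤ (a *ℤ d +ℤ b *ℤ c +ℤ b *ℤ d) *ℤ e
                       +ℤ (a *ℤ d +ℤ b *ℤ c +ℤ b *ℤ d) *ℤ f
                     ≡ a *ℤ (c *ℤ f +ℤ d *ℤ e +ℤ d *ℤ f) +ℤ b *ℤ (c *ℤ e +ℤ -ℤ (d *ℤ f))
                       +ℤ b *ℤ (c *ℤ f +ℤ d *ℤ e +ℤ d *ℤ f)
  im = solve-∀

*E-comm : ∀ x y → x *E y ≡ y *E x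
*E-comm (mkE a b) (mkE c d) = cong₂ mkE (re a b c d) (im a b c d)
  where
  re : ∀ a b c d → a *ℤ c +ℤ -ℤ (b *ℤ d) ≡ c *ℤ a +ℤ -ℤ (d *ℤ b)
  re = solve-∀
  im : ∀ a b c d → a *ℤ d +ℤ b *ℤ c +ℤ b *ℤ d ≡ c *ℤ b +ℤ d *ℤ a +ℤ d *ℤ b
  im = solve-∀

*E-identityˡ : ∀ x → 1E *E x ≡ x
*E-identityˡ (mkE a b) = cong₂ mkE (re a b) (im a b)
  where
  re : ∀ a b → + 1 *ℤ a +ℤ -ℤ (+ 0 *ℤ b) ≡ a
  re = solve-∀
  im : ∀ a b → + 1 *ℤ b +ℤ + 0 *ℤ a +ℤ + 0 *ℤ b ≡ b
  im = solve-∀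

*E-identityʳ : ∀ x → x *E 1E ≡ x
*E-identityʳ x = trans (*E-comm x 1E) (*E-identityˡ x)

*E-distribˡ-+E : ∀ x y z → x *E (y +E z) ≡ x *E y +E x *E z
*E-distribˡ-+E (mkE a b) (mkE c d) (mkE e f) = cong₂ mkE (re a b c d e f) (im a b c d e f)
  where
  re : ∀ a b c d e f → a *ℤ (c +ℤ e) +ℤ -ℤ (b *ℤ (d +ℤ f))
                     ≡ (a *ℤ c +ℤ -ℤ (b *ℤ d)) +ℤ (a *ℤ e +ℤ -ℤ (b *ℤ f))
  re = solve-∀
  im : ∀ a b c d e f → a *ℤ (d +ℤ f) +ℤ b *ℤ (c +ℤ e) +ℤ b *ℤ (d +ℤ f)
                     ≡ (a *ℤ d +ℤ b *ℤ c +ℤ b *ℤ d) +ℤ (a *ℤ f +ℤ b *ℤ e +ℤ b *ℤ f)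
  im = solve-∀

*E-distribʳ-+E : ∀ x y z → (y +E z) *E x ≡ y *E x +E z *E x
*E-distribʳ-+E x y z = begin
  (y +E z) *E x       ≡⟨ *E-comm (y +E z) x ⟩
  x *E (y +E z)       ≡⟨ *E-distribˡ-+E x y z ⟩
  x *E y +E x *E z    ≡⟨ cong₂ _+E_ (*E-comm x y) (*E-comm x z) ⟩
  y *E x +E z *E x    ∎
  where open ≡-Reasoning

𝓔-isCommutativeRing : IsCommutativeRing _≡_ _+E_ _*E_ -E_ 0E 1E
𝓔-isCommutativeRing = record
  { isRing = record
    { +-isAbelianGroup = record
      { isGroup = record
        { isMonoid = record
          { isSemigroup = record
            { isMagma = record { isEquivalence = isEquivalence ; ∙-cong = cong₂ _+E_ }
            ; assoc = +E-assoc }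
          ; identity = +E-identityˡ , +E-identityʳ }
        ; inverse = -E-inverseˡ , -E-inverseʳ
        ; ⁻¹-cong = cong (λ x → -E x) }
      ; comm = +E-comm }
    ; *-cong = cong₂ _*E_
    ; *-assoc = *E-assoc
    ; *-identity = *E-identityˡ , *E-identityʳ
    ; distrib = *E-distribˡ-+E , *E-distribʳ-+E }
  ; *-comm = *E-comm }

𝓔-commutativeRing : CommutativeRing _ _
𝓔-commutativeRing = record { isCommutativeRing = 𝓔-isCommutativeRing }

open CommutativeRing 𝓔-commutativeRing using (semiring; zeroˡ; zeroʳ)

𝓔-ring : AlmostCommutativeRing _ _
𝓔-ring = fromCommutativeRing 𝓔-commutativeRing is-0E
  where
  is-0E : ∀ x → Maybe (0E ≡ x)
  is-0E (mkE (+ zero) (+ zero)) = just refl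
  is-0E _ = nothing

_≟E_ : DecidableEquality 𝓔
mkE a b ≟E mkE c d = map′ (λ (p , q) → cong₂ mkE p q) (λ { refl → refl , refl }) ((a ℤ.≟ c) ×-dec (b ℤ.≟ d))

norm : 𝓔 → ℤ
norm (mkE a b) = a *ℤ a +ℤ a *ℤ b +ℤ b *ℤ b

conj-*E-self : ∀ x → conj x *E x ≡ mkE (norm x) 0ℤ
conj-*E-self (mkE a b) = cong₂ mkE (re a b) (im a b)
  where
  re : ∀ a b → (a +ℤ b) *ℤ a +ℤ -ℤ ((-ℤ b) *ℤ b) ≡ a *ℤ a +ℤ a *ℤ b +ℤ b *ℤ b
  re = solve-∀
  im : ∀ a b → (a +ℤ b) *ℤ b +ℤ (-ℤ b) *ℤ a +ℤ (-ℤ b) *ℤ b ≡ + 0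
  im = solve-∀

i*i≡0⇒i≡0 : ∀ i → i *ℤ i ≡ 0ℤ → i ≡ 0ℤ
i*i≡0⇒i≡0 i = reduce ∘ ℤ.i*j≡0⇒i≡0∨j≡0 i

i*i≡+∣i∣*∣i∣ : ∀ i → i *ℤ i ≡ + (∣ i ∣ *ℕ ∣ i ∣)
i*i≡+∣i∣*∣i∣ (+ n) = ℤ.+◃n≡+n (n *ℕ n)
i*i≡+∣i∣*∣i∣ -[1+ n ] = ℤ.+◃n≡+n (suc n *ℕ suc n)

norm≡0⇒≡0E : ∀ x → norm x ≡ 0ℤ → x ≡ 0E
norm≡0⇒≡0E (mkE a b) N≡0 = cong₂ mkE a≡0 b≡0
  where
  four-norm : ∀ a b → + 4 *ℤ (a *ℤ a +ℤ a *ℤ b +ℤ b *ℤ b)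
                    ≡ (+ 2 *ℤ a +ℤ b) *ℤ (+ 2 *ℤ a +ℤ b) +ℤ + 3 *ℤ (b *ℤ b)
  four-norm = solve-∀
  u = + 2 *ℤ a +ℤ b
  U = ∣ u ∣ *ℕ ∣ u ∣
  B = ∣ b ∣ *ℕ ∣ b ∣
  squares≡0 : + (U +ℕ 3 *ℕ B) ≡ 0ℤ
  squares≡0 = begin
    + (U +ℕ 3 *ℕ B)               ≡⟨ ℤ.pos-+ U (3 *ℕ B) ⟩
    + U +ℤ + (3 *ℕ B)             ≡⟨ cong (+ U +ℤ_) (ℤ.pos-* 3 B) ⟩
    + U +ℤ + 3 *ℤ + B             ≡⟨ cong₂ (λ s t → s +ℤ + 3 *ℤ t) (i*i≡+∣i∣*∣i∣ u) (i*i≡+∣i∣*∣i∣ b) ⟨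
    u *ℤ u +ℤ + 3 *ℤ (b *ℤ b)     ≡⟨ four-norm a b ⟨
    + 4 *ℤ norm (mkE a b)         ≡⟨ cong (+ 4 *ℤ_) N≡0 ⟩
    0ℤ                            ∎
    where open ≡-Reasoning
  b≡0 : b ≡ 0ℤ
  b≡0 = i*i≡0⇒i≡0 b (trans (i*i≡+∣i∣*∣i∣ b)
          (cong +_ (ℕ.*-cancelˡ-≡ B 0 3 (ℕ.m+n≡0⇒n≡0 U (ℤ.+-injective squares≡0)))))
  a≡0 : a ≡ 0ℤ
  a≡0 = i*i≡0⇒i≡0 a (trans (sym (norm-a0 a)) (subst (λ b → norm (mkE a b) ≡ 0ℤ) b≡0 N≡0))
    where norm-a0 : ∀ a → a *ℤ a +ℤ a *ℤ + 0 +ℤ + 0 *ℤ + 0 ≡ a *ℤ a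
          norm-a0 = solve-∀

x≢0∧x*y≡0⇒y≡0 : ∀ x y → x ≢ 0E → x *E y ≡ 0E → y ≡ 0E
x≢0∧x*y≡0⇒y≡0 x (mkE p q) x≢0 xy≡0 = cong₂ mkE (cancel (cong 𝓔.re Ny≡0)) (cancel (cong 𝓔.im Ny≡0))
  where
  N = norm x
  scale : ∀ n p q → mkE n 0ℤ *E mkE p q ≡ mkE (n *ℤ p) (n *ℤ q)
  scale n p q = cong₂ mkE (re n p q) (im n p q)
    where
    re : ∀ n p q → n *ℤ p +ℤ -ℤ (+ 0 *ℤ q) ≡ n *ℤ p
    re = solve-∀
    im : ∀ n p q → n *ℤ q +ℤ + 0 *ℤ p +ℤ + 0 *ℤ q ≡ n *ℤ q
    im = solve-∀
  Ny≡0 : mkE (N *ℤ p) (N *ℤ q) ≡ 0E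
  Ny≡0 = begin
    mkE (N *ℤ p) (N *ℤ q)      ≡⟨ scale N p q ⟨
    mkE N 0ℤ *E mkE p q        ≡⟨ cong (_*E mkE p q) (conj-*E-self x) ⟨
    conj x *E x *E mkE p q     ≡⟨ *E-assoc (conj x) x (mkE p q) ⟩
    conj x *E (x *E mkE p q)   ≡⟨ cong (conj x *E_) xy≡0 ⟩
    conj x *E 0E               ≡⟨ zeroʳ (conj x) ⟩
    0E                         ∎
    where open ≡-Reasoning
  cancel : ∀ {i} → N *ℤ i ≡ 0ℤ → i ≡ 0ℤ
  cancel = [ (λ N≡0 → contradiction (norm≡0⇒≡0E x N≡0) x≢0) , id ] ∘ ℤ.i*j≡0⇒i≡0∨j≡0 N

*E-cancelˡ-≡ : ∀ x {y z} → x ≢ 0E → x *E y ≡ x *E z → y ≡ z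
*E-cancelˡ-≡ x {y} {z} x≢0 xy≡xz = begin
  y                   ≡⟨ y≡y-z+z y z ⟩
  (y -E z) +E z       ≡⟨ cong (_+E z) (x≢0∧x*y≡0⇒y≡0 x (y -E z) x≢0 x[y-z]≡0) ⟩
  0E +E z             ≡⟨ +E-identityˡ z ⟩
  z                   ∎
  where
  open ≡-Reasoning
  y≡y-z+z : ∀ y z → y ≡ (y -E z) +E z
  y≡y-z+z = Solver.solve-∀ 𝓔-ring
  distrib : ∀ x y z → x *E (y -E z) ≡ x *E y -E x *E z
  distrib = Solver.solve-∀ 𝓔-ring
  x[y-z]≡0 : x *E (y -E z) ≡ 0E
  x[y-z]≡0 = trans (distrib x y z) (trans (cong (_-E x *E z) xy≡xz) (-E-inverseʳ (x *E z)))

-- Finite sums, vectors and matrices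

private
  module ∑ = SemiringSum semiring

sumE≡sum : (f : Vec𝓔 k) → sumE f ≡ ∑.sum f
sumE≡sum {zero} f = refl
sumE≡sum {suc k} f = cong (f zero +E_) (sumE≡sum (f ∘ suc))

sumE-cong : {f g : Vec𝓔 k} → f ≗ g → sumE f ≡ sumE g
sumE-cong {f = f} {g} f≗g = begin
  sumE f      ≡⟨ sumE≡sum f ⟩
  ∑.sum f     ≡⟨ ∑.sum-cong-≗ f≗g ⟩
  ∑.sum g     ≡⟨ sumE≡sum g ⟨
  sumE g      ∎
  where open ≡-Reasoning

sumE-zero : (f : Vec𝓔 k) → (∀ j → f j ≡ 0E) → sumE f ≡ 0E
sumE-zero {zero} f f≡0 = refl
sumE-zero {suc k} f f≡0 = cong₂ _+E_ (f≡0 zero) (sumE-zero (f ∘ suc) (f≡0 ∘ suc))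

sumE-distrib-+E : (f g : Vec𝓔 k) → sumE (λ j → f j +E g j) ≡ sumE f +E sumE g
sumE-distrib-+E f g = begin
  sumE (λ j → f j +E g j)      ≡⟨ sumE≡sum _ ⟩
  ∑.sum (λ j → f j +E g j)     ≡⟨ ∑.∑-distrib-+ f g ⟩
  ∑.sum f +E ∑.sum g           ≡⟨ cong₂ _+E_ (sumE≡sum f) (sumE≡sum g) ⟨
  sumE f +E sumE g             ∎
  where open ≡-Reasoning

sumE-distribˡ-*E : ∀ c (f : Vec𝓔 k) → sumE (λ j → c *E f j) ≡ c *E sumE f
sumE-distribˡ-*E c f = begin
  sumE (λ j → c *E f j)     ≡⟨ sumE≡sum _ ⟩
  ∑.sum (λ j → c *E f j)    ≡⟨ ∑.*-distribˡ-sum c f ⟨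
  c *E ∑.sum f              ≡⟨ cong (c *E_) (sumE≡sum f) ⟨
  c *E sumE f               ∎
  where open ≡-Reasoning

sumE-comm : (f : Fin m → Fin n → 𝓔) → sumE (λ i → sumE (f i)) ≡ sumE (λ j → sumE (λ i → f i j))
sumE-comm f = begin
  sumE (λ i → sumE (f i))                  ≡⟨ sumE-cong (λ i → sumE≡sum (f i)) ⟩
  sumE (λ i → ∑.sum (f i))                 ≡⟨ sumE≡sum _ ⟩
  ∑.sum (λ i → ∑.sum (f i))                ≡⟨ ∑.∑-comm f ⟩
  ∑.sum (λ j → ∑.sum (λ i → f i j))        ≡⟨ sumE≡sum _ ⟨
  sumE (λ j → ∑.sum (λ i → f i j))         ≡⟨ sumE-cong (λ j → sumE≡sum (λ i → f i j)) ⟨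
  sumE (λ j → sumE (λ i → f i j))          ∎
  where open ≡-Reasoning

0⃗ : Vec𝓔 n
0⃗ _ = 0E

infixl 6 _-V_
_-V_ : Vec𝓔 n → Vec𝓔 n → Vec𝓔 n
(x -V y) j = x j -E y j

infixl 7 _∙_ _⊙_ _⊗_
_∙_ : Vec𝓔 n → Vec𝓔 n → 𝓔
x ∙ y = sumE (λ j → x j *E y j)

_⊙_ : Vec𝓔 m → Matrix m n → Vec𝓔 n
(x ⊙ A) j = x ∙ (λ i → A i j)

_⊗_ : Matrix m n → Matrix n p → Matrix m p
(A ⊗ B) i = A i ⊙ B

_ᵀ : Matrix m n → Matrix n m
(A ᵀ) j i = A i j

_ᴴ : Matrix m n → Matrix n m
(A ᴴ) j i = conj (A i j)

⊙-cong : {x y : Vec𝓔 m} (A : Matrix m n) → x ≗ y → x ⊙ A ≗ y ⊙ A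
⊙-cong A x≗y j = sumE-cong (λ i → cong (_*E A i j) (x≗y i))

⊙-congʳ : (x : Vec𝓔 m) {A B : Matrix m n} → (∀ i → A i ≗ B i) → x ⊙ A ≗ x ⊙ B
⊙-congʳ x A≗B j = sumE-cong (λ i → cong (x i *E_) (A≗B i j))

0⃗-⊙ : (A : Matrix m n) → 0⃗ ⊙ A ≗ 0⃗
0⃗-⊙ A j = sumE-zero _ (λ i → zeroˡ (A i j))

⊙-distribʳ-+V : (x y : Vec𝓔 m) (A : Matrix m n) → (x +V y) ⊙ A ≗ (x ⊙ A) +V (y ⊙ A)
⊙-distribʳ-+V x y A j = trans (sumE-cong (λ i → *E-distribʳ-+E (A i j) (x i) (y i)))
                              (sumE-distrib-+E _ _)

⊙-·V : ∀ c (x : Vec𝓔 m) (A : Matrix m n) → (c ·V x) ⊙ A ≗ c ·V (x ⊙ A)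
⊙-·V c x A j = trans (sumE-cong (λ i → *E-assoc c (x i) (A i j))) (sumE-distribˡ-*E c _)

⊙-assoc : (x : Vec𝓔 m) (A : Matrix m n) (B : Matrix n p) → (x ⊙ A) ⊙ B ≗ x ⊙ (A ⊗ B)
⊙-assoc x A B k = begin
  sumE (λ j → sumE (λ i → x i *E A i j) *E B j k)
    ≡⟨ sumE-cong (λ j → *E-comm _ (B j k)) ⟩
  sumE (λ j → B j k *E sumE (λ i → x i *E A i j))
    ≡⟨ sumE-cong (λ j → sumE-distribˡ-*E (B j k) _) ⟨
  sumE (λ j → sumE (λ i → B j k *E (x i *E A i j)))
    ≡⟨ sumE-comm _ ⟩
  sumE (λ i → sumE (λ j → B j k *E (x i *E A i j)))
    ≡⟨ sumE-cong (λ i → sumE-cong (λ j → reassoc (B j k) (x i) (A i j))) ⟩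
  sumE (λ i → sumE (λ j → x i *E (A i j *E B j k)))
    ≡⟨ sumE-cong (λ i → sumE-distribˡ-*E (x i) _) ⟩
  sumE (λ i → x i *E sumE (λ j → A i j *E B j k))
    ∎
  where
  open ≡-Reasoning
  reassoc : ∀ b x a → b *E (x *E a) ≡ x *E (a *E b)
  reassoc = Solver.solve-∀ 𝓔-ring

[_↦_] : Fin n → 𝓔 → Vec𝓔 n
[ zero ↦ x ] zero = x
[ zero ↦ x ] (suc j) = 0E
[ suc a ↦ x ] zero = 0E
[ suc a ↦ x ] (suc j) = [ a ↦ x ] j

[↦]-at : (a : Fin n) (x : 𝓔) → [ a ↦ x ] a ≡ x
[↦]-at zero x = refl
[↦]-at (suc a) x = [↦]-at a x

[↦]-off : {a j : Fin n} (x : 𝓔) → a ≢ j → [ a ↦ x ] j ≡ 0E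
[↦]-off {a = zero} {zero} x a≢j = contradiction refl a≢j
[↦]-off {a = zero} {suc j} x a≢j = refl
[↦]-off {a = suc a} {zero} x a≢j = refl
[↦]-off {a = suc a} {suc j} x a≢j = [↦]-off x (a≢j ∘ cong suc)

[↦]-comm : (a j : Fin n) (x : 𝓔) → [ a ↦ x ] j ≡ [ j ↦ x ] a
[↦]-comm zero zero x = refl
[↦]-comm zero (suc j) x = refl
[↦]-comm (suc a) zero x = refl
[↦]-comm (suc a) (suc j) x = [↦]-comm a j x

[↦]-*E : (a : Fin n) (x : 𝓔) (g : Vec𝓔 n) (j : Fin n) → [ a ↦ x ] j *E g j ≡ [ a ↦ x *E g a ] j
[↦]-*E zero x g zero = refl
[↦]-*E zero x g (suc j) = zeroˡ (g (suc j))
[↦]-*E (suc a) x g zero = zeroˡ (g zero)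
[↦]-*E (suc a) x g (suc j) = [↦]-*E a x (g ∘ suc) j

sumE-[↦] : (a : Fin n) (x : 𝓔) → sumE [ a ↦ x ] ≡ x
sumE-[↦] {suc n} zero x = trans (cong (x +E_) (sumE-zero {n} 0⃗ (λ _ → refl))) (+E-identityʳ x)
sumE-[↦] (suc a) x = trans (+E-identityˡ _) (sumE-[↦] a x)

[↦]-∙ : (a : Fin n) (x : 𝓔) (g : Vec𝓔 n) → [ a ↦ x ] ∙ g ≡ x *E g a
[↦]-∙ a x g = trans (sumE-cong ([↦]-*E a x g)) (sumE-[↦] a (x *E g a))

scalarMatrix : 𝓔 → Matrix n n
scalarMatrix c i = [ i ↦ c ]

⊙-scalarMatrix : ∀ c (x : Vec𝓔 n) → x ⊙ scalarMatrix c ≗ c ·V x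
⊙-scalarMatrix c x j = begin
  sumE (λ i → x i *E [ i ↦ c ] j)    ≡⟨ sumE-cong (λ i → trans (*E-comm (x i) _) (cong (_*E x i) ([↦]-comm i j c))) ⟩
  [ j ↦ c ] ∙ x                      ≡⟨ [↦]-∙ j c x ⟩
  c *E x j                           ∎
  where open ≡-Reasoning

-- The lattices Λ and Λ* and the Jacobian

record LinearlyClosed (P : Vec𝓔 n → Set) : Set where
  field
    resp-≗ : ∀ {x y} → x ≗ y → P x → P y
    +-closed : ∀ {x y} → P x → P y → P (x +V y)
    ·-closed : ∀ c {x} → P x → P (c ·V x)

module Congruence {P : Vec𝓔 n → Set} (closed : LinearlyClosed P) where
  open LinearlyClosed closed

  ≈-sym : ∀ {x y} → P (x -V y) → P (y -V x)
  ≈-sym {x} {y} = resp-≗ (λ j → negate (x j) (y j)) ∘ ·-closed (-E 1E)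
    where negate : ∀ a b → -E 1E *E (a -E b) ≡ b -E a
          negate = Solver.solve-∀ 𝓔-ring

  ≈-trans : ∀ {x y z} → P (x -V y) → P (y -V z) → P (x -V z)
  ≈-trans {x} {y} {z} x≈y y≈z = resp-≗ (λ j → telescope (x j) (y j) (z j)) (+-closed x≈y y≈z)
    where telescope : ∀ a b c → (a -E b) +E (b -E c) ≡ a -E c
          telescope = Solver.solve-∀ 𝓔-ring

  ≈-respʳ : ∀ {x y y'} → y ≗ y' → P (x -V y) → P (x -V y')
  ≈-respʳ {x} y≗y' = resp-≗ (λ j → cong (λ t → x j -E t) (y≗y' j))

infixr 5 _⊕_
_⊕_ : (P Q : Vec𝓔 n → Set) → Vec𝓔 n → Set
_⊕_ {n} P Q v = Σ (Vec𝓔 n) λ a → Σ (Vec𝓔 n) λ b → P a × Q b × v ≗ a +V b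

⊕-linearlyClosed : {P Q : Vec𝓔 n → Set} → LinearlyClosed P → LinearlyClosed Q → LinearlyClosed (P ⊕ Q)
⊕-linearlyClosed P-closed Q-closed = record
  { resp-≗ = λ x≗y (a , b , a∈P , b∈Q , x≗a+b) → a , b , a∈P , b∈Q , λ j → trans (sym (x≗y j)) (x≗a+b j)
  ; +-closed = λ (a , b , a∈P , b∈Q , x≗a+b) (a' , b' , a'∈P , b'∈Q , y≗a'+b') →
      a +V a' , b +V b' , P.+-closed a∈P a'∈P , Q.+-closed b∈Q b'∈Q ,
      λ j → trans (cong₂ _+E_ (x≗a+b j) (y≗a'+b' j)) (interchange (a j) (b j) (a' j) (b' j))
  ; ·-closed = λ c (a , b , a∈P , b∈Q , x≗a+b) →
      c ·V a , c ·V b , P.·-closed c a∈P , Q.·-closed c b∈Q ,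
      λ j → trans (cong (c *E_) (x≗a+b j)) (*E-distribˡ-+E c (a j) (b j))
  }
  where
  module P = LinearlyClosed P-closed
  module Q = LinearlyClosed Q-closed
  interchange : ∀ a b a' b' → (a +E b) +E (a' +E b') ≡ (a +E a') +E (b +E b')
  interchange = Solver.solve-∀ 𝓔-ring

module _ (M : Matrix m n) where

  InΛ-linearlyClosed : LinearlyClosed (InΛ M)
  InΛ-linearlyClosed = record
    { resp-≗ = λ x≗y x∈Λ i → trans (sym (⊙-cong (M ᴴ) x≗y i)) (x∈Λ i)
    ; +-closed = λ {x} {y} x∈Λ y∈Λ i →
        trans (⊙-distribʳ-+V x y (M ᴴ) i) (trans (cong₂ _+E_ (x∈Λ i) (y∈Λ i)) (+E-identityˡ 0E))
    ; ·-closed = λ c {x} x∈Λ i → trans (⊙-·V c x (M ᴴ) i) (trans (cong (c *E_) (x∈Λ i)) (zeroʳ c))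
    }

  InΛ*-linearlyClosed : LinearlyClosed (InΛ* M)
  InΛ*-linearlyClosed = record
    { resp-≗ = λ x≗y (d , d≢0 , r , dx≡rM) → d , d≢0 , r , λ j → trans (cong (d *E_) (sym (x≗y j))) (dx≡rM j)
    ; +-closed = λ {x} {y} (d , d≢0 , r , dx≡rM) (d' , d'≢0 , r' , d'y≡r'M) →
        d *E d' , (λ dd'≡0 → d'≢0 (x≢0∧x*y≡0⇒y≡0 d d' d≢0 dd'≡0)) , (d' ·V r) +V (d ·V r') ,
        λ j → begin
          d *E d' *E (x j +E y j)                      ≡⟨ common-denominator d d' (x j) (y j) ⟩
          d' *E (d *E x j) +E d *E (d' *E y j)         ≡⟨ cong₂ (λ s t → d' *E s +E d *E t) (dx≡rM j) (d'y≡r'M j) ⟩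
          d' *E (r ⊙ M) j +E d *E (r' ⊙ M) j           ≡⟨ cong₂ _+E_ (⊙-·V d' r M j) (⊙-·V d r' M j) ⟨
          ((d' ·V r) ⊙ M) j +E ((d ·V r') ⊙ M) j       ≡⟨ ⊙-distribʳ-+V (d' ·V r) (d ·V r') M j ⟨
          (((d' ·V r) +V (d ·V r')) ⊙ M) j             ∎
    ; ·-closed = λ c {x} (d , d≢0 , r , dx≡rM) → d , d≢0 , c ·V r ,
        λ j → trans (left-commute d c (x j)) (trans (cong (c *E_) (dx≡rM j)) (sym (⊙-·V c r M j)))
    }
    where
    open ≡-Reasoning
    common-denominator : ∀ d d' x y → d *E d' *E (x +E y) ≡ d' *E (d *E x) +E d *E (d' *E y)
    common-denominator = Solver.solve-∀ 𝓔-ring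
    left-commute : ∀ d c x → d *E (c *E x) ≡ c *E (d *E x)
    left-commute = Solver.solve-∀ 𝓔-ring

  InL-linearlyClosed : LinearlyClosed (InL M)
  InL-linearlyClosed = ⊕-linearlyClosed InΛ-linearlyClosed InΛ*-linearlyClosed

  gram-inverse⇒annihilator : (K : Matrix m m) (c : 𝓔) → (∀ i → (K ⊗ (M ⊗ M ᴴ)) i ≗ scalarMatrix c i) →
                             ∀ w → JacEq M (c ·V w) 0⃗
  gram-inverse⇒annihilator K c KG≗c w = a , b , a∈Λ , b∈Λ* , split
    where
    open ≡-Reasoning
    u = w ⊙ M ᴴ
    b = (u ⊙ K) ⊙ M
    a = (c ·V w) +V ((-E 1E) ·V b)
    b∈Λ* : InΛ* M b
    b∈Λ* = 1E , (λ ()) , u ⊙ K , λ j → *E-identityˡ (b j)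
    bMᴴ≗cu : b ⊙ M ᴴ ≗ c ·V u
    bMᴴ≗cu j = begin
      (b ⊙ M ᴴ) j                  ≡⟨ ⊙-assoc (u ⊙ K) M (M ᴴ) j ⟩
      ((u ⊙ K) ⊙ (M ⊗ M ᴴ)) j      ≡⟨ ⊙-assoc u K (M ⊗ M ᴴ) j ⟩
      (u ⊙ (K ⊗ (M ⊗ M ᴴ))) j      ≡⟨ ⊙-congʳ u KG≗c j ⟩
      (u ⊙ scalarMatrix c) j       ≡⟨ ⊙-scalarMatrix c u j ⟩
      c *E u j                     ∎
    a∈Λ : InΛ M a
    a∈Λ i = begin
      (a ⊙ M ᴴ) i                                         ≡⟨ ⊙-distribʳ-+V (c ·V w) ((-E 1E) ·V b) (M ᴴ) i ⟩
      ((c ·V w) ⊙ M ᴴ) i +E (((-E 1E) ·V b) ⊙ M ᴴ) i      ≡⟨ cong₂ _+E_ (⊙-·V c w (M ᴴ) i) (⊙-·V (-E 1E) b (M ᴴ) i) ⟩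
      c *E u i +E -E 1E *E (b ⊙ M ᴴ) i                    ≡⟨ cong (λ t → c *E u i +E -E 1E *E t) (bMᴴ≗cu i) ⟩
      c *E u i +E -E 1E *E (c *E u i)                     ≡⟨ cancel (c *E u i) ⟩
      0E                                                  ∎
      where cancel : ∀ x → x +E -E 1E *E x ≡ 0E
            cancel = Solver.solve-∀ 𝓔-ring
    split : (c ·V w) -V 0⃗ ≗ a +V b
    split j = regroup (c *E w j) (b j)
      where regroup : ∀ x y → x -E 0E ≡ (x +E -E 1E *E y) +E y
            regroup = Solver.solve-∀ 𝓔-ring

  Λ*-integral : (R : Matrix n m) → (∀ i → (M ⊗ R) i ≗ scalarMatrix 1E i) →
                ∀ {b} → InΛ* M b → b ≗ (b ⊙ R) ⊙ M
  Λ*-integral R MR≗1 {b} (d , d≢0 , x , db≡xM) j = *E-cancelˡ-≡ d d≢0 (begin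
    d *E b j                       ≡⟨ db≡xM j ⟩
    (x ⊙ M) j                      ≡⟨ ⊙-cong M d[bR]≗x j ⟨
    ((d ·V (b ⊙ R)) ⊙ M) j         ≡⟨ ⊙-·V d (b ⊙ R) M j ⟩
    d *E ((b ⊙ R) ⊙ M) j           ∎)
    where
    open ≡-Reasoning
    d[bR]≗x : d ·V (b ⊙ R) ≗ x
    d[bR]≗x i = begin
      d *E (b ⊙ R) i               ≡⟨ ⊙-·V d b R i ⟨
      ((d ·V b) ⊙ R) i             ≡⟨ ⊙-cong R db≡xM i ⟩
      ((x ⊙ M) ⊙ R) i              ≡⟨ ⊙-assoc x M R i ⟩
      (x ⊙ (M ⊗ R)) i              ≡⟨ ⊙-congʳ x MR≗1 i ⟩
      (x ⊙ scalarMatrix 1E) i      ≡⟨ ⊙-scalarMatrix 1E x i ⟩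
      1E *E x i                    ≡⟨ *E-identityˡ (x i) ⟩
      x i                          ∎

module _ {M : Matrix m n} {M' : Matrix m' n} (iso : JacIso M M') where
  open JacIso iso
  private
    module J = Congruence (InL-linearlyClosed M)
    module J' = Congruence (InL-linearlyClosed M')

  JacIso-preserves-annihilator : ∀ c → (∀ w → JacEq M (c ·V w) 0⃗) → ∀ y → JacEq M' (c ·V y) 0⃗
  JacIso-preserves-annihilator c annihilates y =
    J'.≈-trans {c ·V y} {f (g (c ·V y))} {0⃗} cy≈fgcy (J'.≈-trans {f (g (c ·V y))} {f 0⃗} {0⃗} fgcy≈f0 f0≈0)
    where
    cy≈fgcy : JacEq M' (c ·V y) (f (g (c ·V y)))
    cy≈fgcy = J'.≈-sym {f (g (c ·V y))} {c ·V y} (fg (c ·V y))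
    g[cy]≈0 : JacEq M (g (c ·V y)) 0⃗
    g[cy]≈0 = J.≈-trans {g (c ·V y)} {c ·V g y} {0⃗} (g-· c y) (annihilates (g y))
    fgcy≈f0 : JacEq M' (f (g (c ·V y))) (f 0⃗)
    fgcy≈f0 = f-cong _ _ g[cy]≈0
    -- f-· applies because 0E ·V 0⃗ computes to 0⃗.
    f0≈0 : JacEq M' (f 0⃗) 0⃗
    f0≈0 = J'.≈-respʳ {f 0⃗} {0E ·V f 0⃗} {0⃗} (λ j → zeroˡ (f 0⃗ j)) (f-· 0E 0⃗)

-- Reduction modulo 49

-- ω ↦ 19 defines a ring homomorphism 𝓔 → ℤ/49, as 19² − 19 + 1 = 7³.
ρ : 𝓔 → ℤ
ρ (mkE a b) = a +ℤ + 19 *ℤ b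

Kerρ : 𝓔 → Set
Kerρ x = + 49 ∣ ρ x

ρ-+ : ∀ x y → ρ (x +E y) ≡ ρ x +ℤ ρ y
ρ-+ (mkE a b) (mkE c d) = distrib a b c d
  where distrib : ∀ a b c d → (a +ℤ c) +ℤ + 19 *ℤ (b +ℤ d) ≡ (a +ℤ + 19 *ℤ b) +ℤ (c +ℤ + 19 *ℤ d)
        distrib = solve-∀

ρ-* : ∀ x y → + 49 ∣ ρ (x *E y) -ℤ ρ x *ℤ ρ y
ρ-* (mkE a b) (mkE c d) = divides (-ℤ (+ 7 *ℤ (b *ℤ d))) (defect a b c d)
  where defect : ∀ a b c d → ((a *ℤ c +ℤ -ℤ (b *ℤ d)) +ℤ + 19 *ℤ (a *ℤ d +ℤ b *ℤ c +ℤ b *ℤ d))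
                             -ℤ (a +ℤ + 19 *ℤ b) *ℤ (c +ℤ + 19 *ℤ d) ≡ -ℤ (+ 7 *ℤ (b *ℤ d)) *ℤ + 49
        defect = solve-∀

Kerρ-+ : ∀ x y → Kerρ x → Kerρ y → Kerρ (x +E y)
Kerρ-+ x y 49∣x 49∣y = subst (+ 49 ∣_) (sym (ρ-+ x y)) (∣m∣n⇒∣m+n 49∣x 49∣y)

Kerρ-*ˡ : ∀ y x → Kerρ x → Kerρ (y *E x)
Kerρ-*ˡ y x 49∣x = subst (+ 49 ∣_) (undo (ρ (y *E x)) (ρ y *ℤ ρ x)) (∣m∣n⇒∣m+n (ρ-* y x) (∣n⇒∣m*n (ρ y) 49∣x))
  where undo : ∀ s t → s -ℤ t +ℤ t ≡ s
        undo = solve-∀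

Kerρ-⊙ : (y : Vec𝓔 m) (X : Matrix m n) → (∀ i j → Kerρ (X i j)) → ∀ j → Kerρ ((y ⊙ X) j)
Kerρ-⊙ {m = zero} y X X∈Kerρ j = divides 0ℤ refl
Kerρ-⊙ {m = suc m} y X X∈Kerρ j =
  Kerρ-+ (y zero *E X zero j) (((y ∘ suc) ⊙ (X ∘ suc)) j)
    (Kerρ-*ˡ (y zero) (X zero j) (X∈Kerρ zero j)) (Kerρ-⊙ (y ∘ suc) (X ∘ suc) (X∈Kerρ ∘ suc) j)

module _ (M : Matrix m n) (R : Matrix n m) (MR≗1 : ∀ i → (M ⊗ R) i ≗ scalarMatrix 1E i) where

  Kerρ-on-Jac : (Φ : Matrix m k) → (∀ i q → Kerρ ((M ⊗ (M ᴴ ⊗ Φ)) i q)) →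
                ∀ {v} → InL M v → ∀ q → Kerρ ((v ⊙ (M ᴴ ⊗ Φ)) q)
  Kerρ-on-Jac Φ MMᴴΦ∈Kerρ {v} (a , b , a∈Λ , b∈Λ* , v≗a+b) q =
    subst Kerρ (sym vT≡aT+bT) (Kerρ-+ ((a ⊙ T) q) ((b ⊙ T) q) (subst Kerρ (sym aT≡0) (divides 0ℤ refl)) bT∈Kerρ)
    where
    open ≡-Reasoning
    T = M ᴴ ⊗ Φ
    vT≡aT+bT : (v ⊙ T) q ≡ (a ⊙ T) q +E (b ⊙ T) q
    vT≡aT+bT = trans (⊙-cong T v≗a+b q) (⊙-distribʳ-+V a b T q)
    aT≡0 : (a ⊙ T) q ≡ 0E
    aT≡0 = begin
      (a ⊙ T) q                ≡⟨ ⊙-assoc a (M ᴴ) Φ q ⟨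
      ((a ⊙ M ᴴ) ⊙ Φ) q        ≡⟨ ⊙-cong Φ a∈Λ q ⟩
      (0⃗ ⊙ Φ) q                ≡⟨ 0⃗-⊙ Φ q ⟩
      0E                       ∎
    bT∈Kerρ : Kerρ ((b ⊙ T) q)
    bT∈Kerρ = subst Kerρ (sym (trans (⊙-cong T (Λ*-integral M R MR≗1 b∈Λ*) q) (⊙-assoc (b ⊙ R) M T q)))
                (Kerρ-⊙ (b ⊙ R) (M ⊗ T) MMᴴΦ∈Kerρ q)

-- Matroids of matrices with three rows

col : Matrix 3 n → Fin n → Vec𝓔 3
col N a r = N r a

e : Fin 3 → Vec𝓔 3
e t = [ t ↦ 1E ]

infixl 7 _×₃_
_×₃_ : Vec𝓔 3 → Vec𝓔 3 → Vec𝓔 3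
(v ×₃ w) zero = v (# 1) *E w (# 2) -E v (# 2) *E w (# 1)
(v ×₃ w) (suc zero) = v (# 2) *E w (# 0) -E v (# 0) *E w (# 2)
(v ×₃ w) (suc (suc zero)) = v (# 0) *E w (# 1) -E v (# 1) *E w (# 0)

det3 : Vec𝓔 3 → Vec𝓔 3 → Vec𝓔 3 → 𝓔
det3 u v w = u ∙ (v ×₃ w)

-- The ring solver only sees through ring operations, so the identities below are stated on
-- coordinates, with det3 written out by a let (which Agda inlines).
private
  CramerIdentity : (𝓔 → 𝓔 → 𝓔 → 𝓔) → Set
  CramerIdentity π = ∀ u₀ u₁ u₂ v₀ v₁ v₂ w₀ w₁ w₂ x₀ x₁ x₂ → let
    D = λ a₀ a₁ a₂ b₀ b₁ b₂ c₀ c₁ c₂ →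
          a₀ *E (b₁ *E c₂ -E b₂ *E c₁) +E (a₁ *E (b₂ *E c₀ -E b₀ *E c₂) +E (a₂ *E (b₀ *E c₁ -E b₁ *E c₀) +E 0E))
    in D v₀ v₁ v₂ w₀ w₁ w₂ x₀ x₁ x₂ *E π u₀ u₁ u₂ +E (-E D u₀ u₁ u₂ w₀ w₁ w₂ x₀ x₁ x₂ *E π v₀ v₁ v₂ +E
         (D u₀ u₁ u₂ v₀ v₁ v₂ x₀ x₁ x₂ *E π w₀ w₁ w₂ +E -E D u₀ u₁ u₂ v₀ v₁ v₂ w₀ w₁ w₂ *E π x₀ x₁ x₂)) ≡ 0E

  cramer₀ : CramerIdentity (λ a _ _ → a)
  cramer₀ = Solver.solve-∀ 𝓔-ring
  cramer₁ : CramerIdentity (λ _ a _ → a)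
  cramer₁ = Solver.solve-∀ 𝓔-ring
  cramer₂ : CramerIdentity (λ _ _ a → a)
  cramer₂ = Solver.solve-∀ 𝓔-ring

cramer : ∀ (u v w x : Vec𝓔 3) r →
  det3 v w x *E u r +E (-E det3 u w x *E v r +E (det3 u v x *E w r +E -E det3 u v w *E x r)) ≡ 0E
cramer u v w x zero = cramer₀ (u (# 0)) (u (# 1)) (u (# 2)) (v (# 0)) (v (# 1)) (v (# 2))
                              (w (# 0)) (w (# 1)) (w (# 2)) (x (# 0)) (x (# 1)) (x (# 2))
cramer u v w x (suc zero) = cramer₁ (u (# 0)) (u (# 1)) (u (# 2)) (v (# 0)) (v (# 1)) (v (# 2))
                                    (w (# 0)) (w (# 1)) (w (# 2)) (x (# 0)) (x (# 1)) (x (# 2))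
cramer u v w x (suc (suc zero)) = cramer₂ (u (# 0)) (u (# 1)) (u (# 2)) (v (# 0)) (v (# 1)) (v (# 2))
                                          (w (# 0)) (w (# 1)) (w (# 2)) (x (# 0)) (x (# 1)) (x (# 2))

private
  CramersRule : (𝓔 → 𝓔 → 𝓔 → 𝓔) → Set
  CramersRule π = ∀ u₀ u₁ u₂ v₀ v₁ v₂ w₀ w₁ w₂ k₁ k₂ k₃ → let
    D = λ a₀ a₁ a₂ b₀ b₁ b₂ c₀ c₁ c₂ →
          a₀ *E (b₁ *E c₂ -E b₂ *E c₁) +E (a₁ *E (b₂ *E c₀ -E b₀ *E c₂) +E (a₂ *E (b₀ *E c₁ -E b₁ *E c₀) +E 0E))
    z = λ a b c → k₁ *E a +E (k₂ *E b +E (k₃ *E c +E 0E))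
    in π (D (z u₀ v₀ w₀) (z u₁ v₁ w₁) (z u₂ v₂ w₂) v₀ v₁ v₂ w₀ w₁ w₂)
         (D (z u₀ v₀ w₀) (z u₁ v₁ w₁) (z u₂ v₂ w₂) w₀ w₁ w₂ u₀ u₁ u₂)
         (D (z u₀ v₀ w₀) (z u₁ v₁ w₁) (z u₂ v₂ w₂) u₀ u₁ u₂ v₀ v₁ v₂)
       ≡ π (k₁ *E D u₀ u₁ u₂ v₀ v₁ v₂ w₀ w₁ w₂) (k₂ *E D u₀ u₁ u₂ v₀ v₁ v₂ w₀ w₁ w₂)
           (k₃ *E D u₀ u₁ u₂ v₀ v₁ v₂ w₀ w₁ w₂)

  cramers-rule₁ : CramersRule (λ a _ _ → a)
  cramers-rule₁ = Solver.solve-∀ 𝓔-ring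
  cramers-rule₂ : CramersRule (λ _ a _ → a)
  cramers-rule₂ = Solver.solve-∀ 𝓔-ring
  cramers-rule₃ : CramersRule (λ _ _ a → a)
  cramers-rule₃ = Solver.solve-∀ 𝓔-ring

det3-zeroˡ : ∀ (z v w : Vec𝓔 3) → z ≗ 0⃗ → det3 z v w ≡ 0E
det3-zeroˡ z v w z≗0 = sumE-zero _ (λ r → trans (cong (_*E (v ×₃ w) r) (z≗0 r)) (zeroˡ ((v ×₃ w) r)))

det3≢0⇒independent : ∀ (u v w : Vec𝓔 3) k₁ k₂ k₃ → det3 u v w ≢ 0E →
  (∀ r → k₁ *E u r +E (k₂ *E v r +E (k₃ *E w r +E 0E)) ≡ 0E) → k₁ ≡ 0E × k₂ ≡ 0E × k₃ ≡ 0E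
det3≢0⇒independent u v w k₁ k₂ k₃ D≢0 z≗0 =
  cancel k₁ (apply (λ a _ _ → a) cramers-rule₁ (det3-zeroˡ z v w z≗0)) ,
  cancel k₂ (apply (λ _ a _ → a) cramers-rule₂ (det3-zeroˡ z w u z≗0)) ,
  cancel k₃ (apply (λ _ _ a → a) cramers-rule₃ (det3-zeroˡ z u v z≗0))
  where
  D = det3 u v w
  z : Vec𝓔 3
  z r = k₁ *E u r +E (k₂ *E v r +E (k₃ *E w r +E 0E))
  apply : ∀ π → CramersRule π →
          π (det3 z v w) (det3 z w u) (det3 z u v) ≡ 0E → π (k₁ *E D) (k₂ *E D) (k₃ *E D) ≡ 0E
  apply π rule = trans (sym (rule (u (# 0)) (u (# 1)) (u (# 2)) (v (# 0)) (v (# 1)) (v (# 2))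
                                 (w (# 0)) (w (# 1)) (w (# 2)) k₁ k₂ k₃))
  cancel : ∀ k → k *E D ≡ 0E → k ≡ 0E
  cancel k kD≡0 = x≢0∧x*y≡0⇒y≡0 D k D≢0 (trans (*E-comm D k) kD≡0)

Dependent : Matrix 3 n → Subset n → Set
Dependent {n} N S = ∃ λ (c : Vec𝓔 n) → (∀ j → j ∉ S → c j ≡ 0E) × c ⊙ N ᵀ ≗ 0⃗ × ∃ λ j → c j ≢ 0E

Dependent⇒¬IndepCols : ∀ {N : Matrix 3 n} → Dependent N S → ¬ IndepCols N S
Dependent⇒¬IndepCols (c , supported , c⊙Nᵀ≗0 , j , cj≢0) independent = cj≢0 (independent c supported c⊙Nᵀ≗0 j)

-- The Cramer identity among three slots (unit vectors e t or columns of N) and a further column d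
-- of N gives a dependency supported on S as soon as every unit slot has coefficient 0.
Slot : ℕ → Set
Slot n = Fin 3 ⊎ Fin n

slotVector : Matrix 3 n → Slot n → Vec𝓔 3
slotVector N (inj₁ t) = e t
slotVector N (inj₂ a) = col N a

Realisable : Subset n → Slot n → 𝓔 → Set
Realisable S (inj₁ t) k = k ≡ 0E
Realisable S (inj₂ a) k = a ∈ S

embed : Slot n → 𝓔 → Vec𝓔 n
embed (inj₁ t) k = 0⃗
embed (inj₂ a) k = [ a ↦ k ]

embed-⊙ : (N : Matrix 3 n) (s : Slot n) {k : 𝓔} → Realisable S s k → embed s k ⊙ N ᵀ ≗ k ·V slotVector N s
embed-⊙ N (inj₁ t) refl r = trans (0⃗-⊙ (N ᵀ) r) (sym (zeroˡ (e t r)))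
embed-⊙ N (inj₂ a) {k} _ r = [↦]-∙ a k (λ j → N r j)

embed-supported : (s : Slot n) {k : 𝓔} → Realisable S s k → ∀ j → j ∉ S → embed s k j ≡ 0E
embed-supported (inj₁ t) _ j _ = refl
embed-supported {S = S} (inj₂ a) {k} a∈S j j∉S = [↦]-off k (λ a≡j → j∉S (subst (_∈ S) a≡j a∈S))

embed-off : (s : Slot n) {k : 𝓔} {j : Fin n} → s ≢ inj₂ j → embed s k j ≡ 0E
embed-off (inj₁ t) _ = refl
embed-off (inj₂ a) {k} s≢j = [↦]-off k (s≢j ∘ cong inj₂)

module _ (N : Matrix 3 n) (s₁ s₂ s₃ : Slot n) (d : Fin n) where
  private
    u = slotVector N s₁
    v = slotVector N s₂
    w = slotVector N s₃
    x = col N d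
    k₁ = det3 v w x
    k₂ = -E det3 u w x
    k₃ = det3 u v x
    k₄ = -E det3 u v w

  cramer-dependency : ∀ {S} → Realisable S s₁ k₁ → Realisable S s₂ k₂ → Realisable S s₃ k₃ → d ∈ S →
                      s₁ ≢ inj₂ d → s₂ ≢ inj₂ d → s₃ ≢ inj₂ d → det3 u v w ≢ 0E → Dependent N S
  cramer-dependency {S} ρ₁ ρ₂ ρ₃ d∈S s₁≢d s₂≢d s₃≢d D≢0 = c , supported , relation , d , c[d]≢0
    where
    open ≡-Reasoning
    c = embed s₁ k₁ +V (embed s₂ k₂ +V (embed s₃ k₃ +V [ d ↦ k₄ ]))
    supported : ∀ j → j ∉ S → c j ≡ 0E
    supported j j∉S = cong₂ _+E_ (embed-supported s₁ ρ₁ j j∉S) (cong₂ _+E_ (embed-supported s₂ ρ₂ j j∉S)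
                        (cong₂ _+E_ (embed-supported s₃ ρ₃ j j∉S) (embed-supported (inj₂ d) d∈S j j∉S)))
    relation : c ⊙ N ᵀ ≗ 0⃗
    relation r = begin
      (c ⊙ N ᵀ) r
        ≡⟨ ⊙-distribʳ-+V (embed s₁ k₁) _ (N ᵀ) r ⟩
      (embed s₁ k₁ ⊙ N ᵀ) r +E ((embed s₂ k₂ +V (embed s₃ k₃ +V [ d ↦ k₄ ])) ⊙ N ᵀ) r
        ≡⟨ cong ((embed s₁ k₁ ⊙ N ᵀ) r +E_) (trans (⊙-distribʳ-+V (embed s₂ k₂) _ (N ᵀ) r)
             (cong ((embed s₂ k₂ ⊙ N ᵀ) r +E_) (⊙-distribʳ-+V (embed s₃ k₃) _ (N ᵀ) r))) ⟩
      (embed s₁ k₁ ⊙ N ᵀ) r +E ((embed s₂ k₂ ⊙ N ᵀ) r +E ((embed s₃ k₃ ⊙ N ᵀ) r +E ([ d ↦ k₄ ] ⊙ N ᵀ) r))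
        ≡⟨ cong₂ _+E_ (embed-⊙ N s₁ ρ₁ r) (cong₂ _+E_ (embed-⊙ N s₂ ρ₂ r)
             (cong₂ _+E_ (embed-⊙ N s₃ ρ₃ r) (embed-⊙ N (inj₂ d) {k₄} d∈S r))) ⟩
      k₁ *E u r +E (k₂ *E v r +E (k₃ *E w r +E k₄ *E x r))
        ≡⟨ cramer u v w x r ⟩
      0E ∎
    c[d]≢0 : c d ≢ 0E
    c[d]≢0 c[d]≡0 = D≢0 (begin
      det3 u v w                                ≡⟨ double-negation (det3 u v w) ⟩
      -E k₄                                     ≡⟨ cong -E_ (trans (sym c[d]≡k₄) c[d]≡0) ⟩
      -E 0E                                     ∎)
      where
      double-negation : ∀ x → x ≡ -E (-E x)
      double-negation = Solver.solve-∀ 𝓔-ring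
      c[d]≡k₄ : c d ≡ k₄
      c[d]≡k₄ = trans (cong₂ _+E_ (embed-off s₁ s₁≢d) (cong₂ _+E_ (embed-off s₂ s₂≢d)
                        (cong₂ _+E_ (embed-off s₃ s₃≢d) ([↦]-at d k₄))))
                      (trans (+E-identityˡ _) (trans (+E-identityˡ _) (+E-identityˡ _)))

all-zero-or-witness : (f : Fin k → 𝓔) → (∀ t → f t ≡ 0E) ⊎ ∃ λ t → f t ≢ 0E
all-zero-or-witness f with all? (λ t → f t ≟E 0E)
... | yes all≡0 = inj₁ all≡0
... | no ¬all≡0 = inj₂ (¬∀⟶∃¬ _ _ (λ t → f t ≟E 0E) ¬all≡0)

all-zero-or-witness₂ : (f : Fin k → Fin k → 𝓔) → (∀ s t → f s t ≡ 0E) ⊎ ∃₂ λ s t → f s t ≢ 0E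
all-zero-or-witness₂ f with all? (λ s → all? (λ t → f s t ≟E 0E))
... | yes all≡0 = inj₁ all≡0
... | no ¬all≡0 with ¬∀⟶∃¬ _ _ (λ s → all? (λ t → f s t ≟E 0E)) ¬all≡0
...   | s , ¬all-t≡0 = inj₂ (s , ¬∀⟶∃¬ _ _ (λ t → f s t ≟E 0E) ¬all-t≡0)

module _ (N : Matrix 3 n) where

  dependent₁ : ∀ {a} → a ∈ S → (∀ s t → det3 (e s) (e t) (col N a) ≡ 0E) → Dependent N S
  dependent₁ {a = a} a∈S minors≡0 =
    cramer-dependency N (inj₁ (# 0)) (inj₁ (# 1)) (inj₁ (# 2)) a
      (minors≡0 (# 1) (# 2)) (cong -E_ (minors≡0 (# 0) (# 2))) (minors≡0 (# 0) (# 1)) a∈S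
      (λ ()) (λ ()) (λ ()) (λ ())

  dependent₂ : ∀ {a b} → a ∈ S → b ∈ S → a ≢ b → (∀ t → det3 (e t) (col N a) (col N b) ≡ 0E) → Dependent N S
  dependent₂ {a = a} {b} a∈S b∈S a≢b minors≡0
    with all-zero-or-witness₂ (λ s t → det3 (e s) (e t) (col N a))
  ... | inj₁ all≡0 = dependent₁ a∈S all≡0
  ... | inj₂ (s , t , minor≢0) =
    cramer-dependency N (inj₁ s) (inj₁ t) (inj₂ a) b (minors≡0 t) (cong -E_ (minors≡0 s)) a∈S b∈S
      (λ ()) (λ ()) (a≢b ∘ inj₂-injective) minor≢0

  dependent₃ : ∀ {a b c} → a ∈ S → b ∈ S → c ∈ S → a ≢ b → a ≢ c → b ≢ c →
               det3 (col N a) (col N b) (col N c) ≡ 0E → Dependent N S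
  dependent₃ {a = a} {b} {c} a∈S b∈S c∈S a≢b a≢c b≢c minor≡0
    with all-zero-or-witness (λ t → det3 (e t) (col N a) (col N b))
  ... | inj₁ all≡0 = dependent₂ a∈S b∈S a≢b all≡0
  ... | inj₂ (t , minor≢0) =
    cramer-dependency N (inj₁ t) (inj₂ a) (inj₂ b) c minor≡0 a∈S b∈S c∈S
      (λ ()) (a≢c ∘ inj₂-injective) (b≢c ∘ inj₂-injective) minor≢0

  dependent₄ : ∀ {a b c d} → a ∈ S → b ∈ S → c ∈ S → d ∈ S →
               a ≢ b → a ≢ c → a ≢ d → b ≢ c → b ≢ d → c ≢ d → Dependent N S
  dependent₄ {a = a} {b} {c} {d} a∈S b∈S c∈S d∈S a≢b a≢c a≢d b≢c b≢d c≢d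
    with det3 (col N a) (col N b) (col N c) ≟E 0E
  ... | yes minor≡0 = dependent₃ a∈S b∈S c∈S a≢b a≢c b≢c minor≡0
  ... | no minor≢0 =
    cramer-dependency N (inj₂ a) (inj₂ b) (inj₂ c) d a∈S b∈S c∈S d∈S
      (a≢d ∘ inj₂-injective) (b≢d ∘ inj₂-injective) (c≢d ∘ inj₂-injective) minor≢0

sumE-supported : (L : List (Fin n)) → Unique L → (f : Vec𝓔 n) → (∀ j → j ∉ₗ L → f j ≡ 0E) →
                 sumE f ≡ foldr _+E_ 0E (map f L)
sumE-supported [] _ f f≡0 = sumE-zero f (λ j → f≡0 j (λ ()))
sumE-supported (a ∷ L) (a∉L ∷ unique) f f≡0 = begin
  sumE f                                  ≡⟨ sumE-cong (λ j → split (f j) ([ a ↦ f a ] j)) ⟩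
  sumE ([ a ↦ f a ] +V f')                ≡⟨ sumE-distrib-+E [ a ↦ f a ] f' ⟩
  sumE [ a ↦ f a ] +E sumE f'             ≡⟨ cong₂ _+E_ (sumE-[↦] a (f a)) (sumE-supported L unique f' f'≡0) ⟩
  f a +E foldr _+E_ 0E (map f' L)         ≡⟨ cong (λ l → f a +E foldr _+E_ 0E l) (map-cong-local (All.map f'≡f a∉L)) ⟩
  f a +E foldr _+E_ 0E (map f L)          ∎
  where
  open ≡-Reasoning
  f' = f -V [ a ↦ f a ]
  split : ∀ x y → x ≡ y +E (x -E y)
  split = Solver.solve-∀ 𝓔-ring
  f'≡f : ∀ {j} → a ≢ j → f' j ≡ f j
  f'≡f {j} a≢j = trans (cong (λ y → f j -E y) ([↦]-off (f a) a≢j)) (+E-identityʳ (f j))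
  f'≡0 : ∀ j → j ∉ₗ L → f' j ≡ 0E
  f'≡0 j j∉L with a ≟ j
  ... | yes refl = trans (cong (λ y → f a -E y) ([↦]-at a (f a))) (-E-inverseʳ (f a))
  ... | no a≢j = trans (f'≡f a≢j) (f≡0 j λ { (here j≡a) → a≢j (sym j≡a) ; (there j∈L) → j∉L j∈L })

members : Subset n → List (Fin n)
members {n} S = filter (_∈? S) (allFin n)

members-complete : ∀ {j} → j ∈ S → j ∈ₗ members S
members-complete {S = S} {j} j∈S = ∈-filter⁺ (_∈? S) (∈-allFin j) j∈S

members-unique : (S : Subset n) → Unique (members S)
members-unique {n} S = filter⁺ (_∈? S) (allFin⁺ n)

members-sound : ∀ {j} → j ∈ₗ members S → j ∈ S
members-sound {n} {S} = proj₂ ∘ ∈-filter⁻ (_∈? S) {xs = allFin n}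

IndependentColumns : Matrix 3 n → List (Fin n) → Set
IndependentColumns {n} N L =
  ∀ (c : Vec𝓔 n) → (∀ r → foldr _+E_ 0E (map (λ a → c a *E N r a) L) ≡ 0E) → All (λ a → c a ≡ 0E) L

IndependentColumns⇒IndepCols : (N : Matrix 3 n) (L : List (Fin n)) → Unique L → (∀ {j} → j ∈ S → j ∈ₗ L) →
                              IndependentColumns N L → IndepCols N S
IndependentColumns⇒IndepCols {S = S} N L unique complete independent c supported c⊙Nᵀ≗0 j with j ∈? S
... | yes j∈S = All.lookup (independent c relation) (complete j∈S)
  where
  relation : ∀ r → foldr _+E_ 0E (map (λ a → c a *E N r a) L) ≡ 0E
  relation r = trans (sym (sumE-supported L unique (λ a → c a *E N r a) vanishes)) (c⊙Nᵀ≗0 r)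
    where vanishes : ∀ a → a ∉ₗ L → c a *E N r a ≡ 0E
          vanishes a a∉L = trans (cong (_*E N r a) (supported a (a∉L ∘ complete))) (zeroˡ (N r a))
... | no j∉S = supported j j∉S

private
  unpad : ∀ x {y} → y ≡ 0E → 0E *E x +E y ≡ 0E
  unpad x y≡0 = trans (cong₂ _+E_ (zeroˡ x) y≡0) (+E-identityˡ 0E)

module _ (N : Matrix 3 n) where

  independent₁ : ∀ s t {a} → det3 (e s) (e t) (col N a) ≢ 0E → IndependentColumns N (a ∷ [])
  independent₁ s t {a} minor≢0 c relation =
    let _ , _ , ca≡0 = det3≢0⇒independent (e s) (e t) (col N a) 0E 0E (c a) minor≢0
                         (λ r → unpad (e s r) (unpad (e t r) (relation r)))
    in ca≡0 ∷ []

  independent₂ : ∀ t {a b} → det3 (e t) (col N a) (col N b) ≢ 0E → IndependentColumns N (a ∷ b ∷ [])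
  independent₂ t {a} {b} minor≢0 c relation =
    let _ , ca≡0 , cb≡0 = det3≢0⇒independent (e t) (col N a) (col N b) 0E (c a) (c b) minor≢0
                            (λ r → unpad (e t r) (relation r))
    in ca≡0 ∷ cb≡0 ∷ []

  independent₃ : ∀ {a b c} → det3 (col N a) (col N b) (col N c) ≢ 0E → IndependentColumns N (a ∷ b ∷ c ∷ [])
  independent₃ {a} {b} {c} minor≢0 k relation =
    let ka≡0 , kb≡0 , kc≡0 = det3≢0⇒independent (col N a) (col N b) (col N c) (k a) (k b) (k c) minor≢0 relation
    in ka≡0 ∷ kb≡0 ∷ kc≡0 ∷ []

-- Up to sign, the minors of size 1 and 2 of N are det3 (e s) (e t) (col N a) and
-- det3 (e t) (col N a) (col N b).
record NonzeroMinorsPreserved (N N' : Matrix 3 n) : Set where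
  field
    minor₁ : ∀ s t a → det3 (e s) (e t) (col N a) ≢ 0E → det3 (e s) (e t) (col N' a) ≢ 0E
    minor₂ : ∀ t a b → det3 (e t) (col N a) (col N b) ≢ 0E → det3 (e t) (col N' a) (col N' b) ≢ 0E
    minor₃ : ∀ a b c → det3 (col N a) (col N b) (col N c) ≢ 0E → det3 (col N' a) (col N' b) (col N' c) ≢ 0E

nonzeroMinorsPreserved? : (N N' : Matrix 3 n) → Dec (NonzeroMinorsPreserved N N')
nonzeroMinorsPreserved? N N' = map′
  (λ (p₁ , p₂ , p₃) → record { minor₁ = p₁ ; minor₂ = p₂ ; minor₃ = p₃ })
  (λ p → NonzeroMinorsPreserved.minor₁ p , NonzeroMinorsPreserved.minor₂ p , NonzeroMinorsPreserved.minor₃ p)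
  (     (all? λ s → all? λ t → all? λ a → preserves? (det3 (e s) (e t) (col N a)) (det3 (e s) (e t) (col N' a)))
   ×-dec (all? λ t → all? λ a → all? λ b →
            preserves? (det3 (e t) (col N a) (col N b)) (det3 (e t) (col N' a) (col N' b)))
   ×-dec (all? λ a → all? λ b → all? λ c →
            preserves? (det3 (col N a) (col N b) (col N c)) (det3 (col N' a) (col N' b) (col N' c))))
  where preserves? : ∀ x y → Dec (x ≢ 0E → y ≢ 0E)
        preserves? x y = ¬? (x ≟E 0E) →-dec ¬? (y ≟E 0E)

module _ {N N' : Matrix 3 n} (preserved : NonzeroMinorsPreserved N N') (independent : IndepCols N S) where
  open NonzeroMinorsPreserved preserved
  private
    impossible : Dependent N S → ∀ {L} → IndependentColumns N' L
    impossible dependence = contradiction independent (Dependent⇒¬IndepCols dependence)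

  transfer₁ : ∀ {a} → a ∈ S → IndependentColumns N' (a ∷ [])
  transfer₁ {a} a∈S with all-zero-or-witness₂ (λ s t → det3 (e s) (e t) (col N a))
  ... | inj₁ minors≡0 = impossible (dependent₁ N a∈S minors≡0)
  ... | inj₂ (s , t , minor≢0) = independent₁ N' s t (minor₁ s t a minor≢0)

  transfer₂ : ∀ {a b} → a ∈ S → b ∈ S → a ≢ b → IndependentColumns N' (a ∷ b ∷ [])
  transfer₂ {a} {b} a∈S b∈S a≢b with all-zero-or-witness (λ t → det3 (e t) (col N a) (col N b))
  ... | inj₁ minors≡0 = impossible (dependent₂ N a∈S b∈S a≢b minors≡0)
  ... | inj₂ (t , minor≢0) = independent₂ N' t (minor₂ t a b minor≢0)

  transfer₃ : ∀ {a b c} → a ∈ S → b ∈ S → c ∈ S → a ≢ b → a ≢ c → b ≢ c → IndependentColumns N' (a ∷ b ∷ c ∷ [])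
  transfer₃ {a} {b} {c} a∈S b∈S c∈S a≢b a≢c b≢c with det3 (col N a) (col N b) (col N c) ≟E 0E
  ... | yes minor≡0 = impossible (dependent₃ N a∈S b∈S c∈S a≢b a≢c b≢c minor≡0)
  ... | no minor≢0 = independent₃ N' (minor₃ a b c minor≢0)

  transfer : (L : List (Fin n)) → Unique L → All (_∈ S) L → IndependentColumns N' L
  transfer [] _ _ _ _ = []
  transfer (a ∷ []) _ (a∈S ∷ []) = transfer₁ a∈S
  transfer (a ∷ b ∷ []) ((a≢b ∷ []) ∷ _) (a∈S ∷ b∈S ∷ []) = transfer₂ a∈S b∈S a≢b
  transfer (a ∷ b ∷ c ∷ []) ((a≢b ∷ a≢c ∷ []) ∷ (b≢c ∷ []) ∷ _) (a∈S ∷ b∈S ∷ c∈S ∷ []) =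
    transfer₃ a∈S b∈S c∈S a≢b a≢c b≢c
  transfer (a ∷ b ∷ c ∷ d ∷ _) ((a≢b ∷ a≢c ∷ a≢d ∷ _) ∷ (b≢c ∷ b≢d ∷ _) ∷ (c≢d ∷ _) ∷ _) (a∈S ∷ b∈S ∷ c∈S ∷ d∈S ∷ _) =
    impossible (dependent₄ N a∈S b∈S c∈S d∈S a≢b a≢c a≢d b≢c b≢d c≢d)

  IndepCols-transfer : IndepCols N' S
  IndepCols-transfer = IndependentColumns⇒IndepCols N' (members S) (members-unique S) members-complete
    (transfer (members S) (members-unique S) (All.tabulate members-sound))

NonzeroMinorsPreserved⇒SameMatroid : {N N' : Matrix 3 n} →
  NonzeroMinorsPreserved N N' → NonzeroMinorsPreserved N' N → SameMatroid N N'
NonzeroMinorsPreserved⇒SameMatroid preserved preserved′ S =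
  IndepCols-transfer preserved , IndepCols-transfer preserved′

-- ℍ-matrices with three rows

submatrix : Matrix m n → (Fin k → Fin m) → (Fin k → Fin n) → Matrix k k
submatrix A r c i j = A (r i) (c j)

isH? : (z : 𝓔) → Dec (IsH z)
isH? z = (z ≟E 0E) ⊎-dec ((z ^E 6) ≟E 1E)

increasing-in-Fin3 : ∀ {x y z : Fin 3} → x < y → y < z → x ≡ # 0 × y ≡ # 1 × z ≡ # 2
increasing-in-Fin3 {x} {y} {z} = from-yes
  (all? λ (x : Fin 3) → all? λ (y : Fin 3) → all? λ (z : Fin 3) →
     (x <? y) →-dec (y <? z) →-dec (x ≟ # 0) ×-dec (y ≟ # 1) ×-dec (z ≟ # 2)) x y z

HMinors : Matrix 3 n → Set
HMinors N = (∀ i a → IsH (det (submatrix N (λ (_ : Fin 1) → i) (λ _ → a))))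
          × (∀ i i' a b → IsH (det (submatrix N (lookup (i ∷ i' ∷ [])) (lookup (a ∷ b ∷ [])))))
          × (∀ a b c → IsH (det (submatrix N id (lookup (a ∷ b ∷ c ∷ [])))))

HMinors? : (N : Matrix 3 n) → Dec (HMinors N)
HMinors? N = (all? λ i → all? λ a → isH? _)
       ×-dec (all? λ i → all? λ i' → all? λ a → all? λ b → isH? _)
       ×-dec (all? λ a → all? λ b → all? λ c → isH? _)

-- Each case identifies the two determinants by an explicitly typed equation: leaving Agda to unify
-- the IsH types instead makes it expand the sixth powers inside IsH.
HMinors⇒IsHMatrix : (N : Matrix 3 n) → HMinors N → IsHMatrix N
HMinors⇒IsHMatrix N _ zero r c _ _ = inj₂ refl
HMinors⇒IsHMatrix N (h₁ , _) 1 r c _ _ = subst IsH same-det (h₁ (r zero) (c zero))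
  where same-det : det (submatrix N (λ (_ : Fin 1) → r zero) (λ _ → c zero)) ≡ det (λ i j → N (r i) (c j))
        same-det = refl
HMinors⇒IsHMatrix N (_ , h₂ , _) 2 r c _ _ = subst IsH same-det (h₂ (r zero) (r (# 1)) (c zero) (c (# 1)))
  where same-det : det (submatrix N (lookup (r zero ∷ r (# 1) ∷ [])) (lookup (c zero ∷ c (# 1) ∷ [])))
                 ≡ det (λ i j → N (r i) (c j))
        same-det = refl
HMinors⇒IsHMatrix N (_ , _ , h₃) 3 r c r↑ _ = subst IsH same-det (h₃ (c zero) (c (# 1)) (c (# 2)))
  where
  rows = increasing-in-Fin3 (r↑ (# 0) (# 1) (s≤s z≤n)) (r↑ (# 1) (# 2) (s≤s (s≤s z≤n)))
  minor : Fin 3 → Fin 3 → Fin 3 → 𝓔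
  minor x y z = det (submatrix N (lookup (x ∷ y ∷ z ∷ [])) c)
  same-det : det (submatrix N id (lookup (c zero ∷ c (# 1) ∷ c (# 2) ∷ []))) ≡ det (λ i j → N (r i) (c j))
  same-det = begin
    det (submatrix N id (lookup (c zero ∷ c (# 1) ∷ c (# 2) ∷ [])))
      ≡⟨⟩
    minor (# 0) (# 1) (# 2)
      ≡⟨ cong (λ x → minor x (# 1) (# 2)) (proj₁ rows) ⟨
    minor (r zero) (# 1) (# 2)
      ≡⟨ cong₂ (minor (r zero)) (proj₁ (proj₂ rows)) (proj₂ (proj₂ rows)) ⟨
    minor (r zero) (r (# 1)) (r (# 2))
      ≡⟨⟩
    det (λ i j → N (r i) (c j))
      ∎
    where open ≡-Reasoning
HMinors⇒IsHMatrix N _ (suc (suc (suc (suc k)))) r c r↑ _ =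
  contradiction (trans (sym (proj₁ rows₁₂₃)) (proj₁ (proj₂ rows₀₁₂))) λ ()
  where
  rows₀₁₂ = increasing-in-Fin3 (r↑ (# 0) (# 1) (s≤s z≤n)) (r↑ (# 1) (# 2) (s≤s (s≤s z≤n)))
  rows₁₂₃ = increasing-in-Fin3 (r↑ (# 1) (# 2) (s≤s (s≤s z≤n))) (r↑ (# 2) (# 3) (s≤s (s≤s (s≤s z≤n))))

-- The example

matrixWith : 𝓔 → Matrix 3 14
matrixWith z r c = lookup (lookup rows r) c
  where
  o i ω : 𝓔
  o = 0E
  i = 1E
  ω = ωE
  rows : Vec (Vec 𝓔 14) 3
  rows = (o ∷ o ∷ i ∷ i ∷ i ∷ i ∷ i ∷ i ∷ i ∷ i ∷ i ∷ i ∷ i ∷ i ∷ [])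
       ∷ (i ∷ o ∷ i ∷ i ∷ ω ∷ ω ∷ ω ∷ ω ∷ o ∷ o ∷ o ∷ o ∷ o ∷ o ∷ [])
       ∷ (o ∷ i ∷ o ∷ o ∷ o ∷ o ∷ o ∷ o ∷ i ∷ i ∷ z ∷ z ∷ z ∷ z ∷ [])
       ∷ []

M M' : Matrix 3 14
M = matrixWith ωE
M' = matrixWith (conj ωE)

M-isH : IsHMatrix M
M-isH = HMinors⇒IsHMatrix M (from-yes (HMinors? M))

M'-isH : IsHMatrix M'
M'-isH = HMinors⇒IsHMatrix M' (from-yes (HMinors? M'))

M≈M' : SameMatroid M M'
M≈M' = NonzeroMinorsPreserved⇒SameMatroid
  (from-yes (nonzeroMinorsPreserved? M M')) (from-yes (nonzeroMinorsPreserved? M' M))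

28E : 𝓔
28E = mkE (+ 28) (+ 0)

-- 28 (M Mᴴ)⁻¹
gramInverse : Matrix 3 3
gramInverse r c = lookup (lookup rows r) c
  where
  rows : Vec (Vec 𝓔 3) 3
  rows = (mkE (+ 7) (+ 0) ∷ mkE -[1+ 5 ] (+ 4) ∷ mkE -[1+ 5 ] (+ 4) ∷ [])
       ∷ (mkE -[1+ 1 ] -[1+ 3 ] ∷ mkE (+ 8) (+ 0) ∷ mkE (+ 4) (+ 0) ∷ [])
       ∷ (mkE -[1+ 1 ] -[1+ 3 ] ∷ mkE (+ 4) (+ 0) ∷ mkE (+ 8) (+ 0) ∷ [])
       ∷ []

gramInverse-correct : ∀ i → (gramInverse ⊗ (M ⊗ M ᴴ)) i ≗ scalarMatrix 28E i
gramInverse-correct = from-yes (all? λ i → all? λ j → (gramInverse ⊗ (M ⊗ M ᴴ)) i j ≟E scalarMatrix 28E i j)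

28-annihilates-Jac-M : ∀ w → JacEq M (28E ·V w) 0⃗
28-annihilates-Jac-M = gram-inverse⇒annihilator M gramInverse 28E gramInverse-correct

-- Columns 2 − 0, 0 and 1 of M' are the unit vectors.
M'-rightInverse : Matrix 14 3
M'-rightInverse zero zero = -E 1E
M'-rightInverse zero (suc zero) = 1E
M'-rightInverse (suc zero) (suc (suc zero)) = 1E
M'-rightInverse (suc (suc zero)) zero = 1E
M'-rightInverse _ _ = 0E

M'-rightInverse-correct : ∀ i → (M' ⊗ M'-rightInverse) i ≗ scalarMatrix 1E i
M'-rightInverse-correct = from-yes (all? λ i → all? λ j → (M' ⊗ M'-rightInverse) i j ≟E scalarMatrix 1E i j)

-- A solution of ρ (M' M'ᴴ Φ) ≡ 0 modulo 49 whose middle entry is a unit modulo 7.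
Φ : Matrix 3 1
Φ r _ = lookup (mkE (+ 42) (+ 0) ∷ 1E ∷ mkE (+ 7) (+ 0) ∷ []) r

M'M'ᴴΦ∈Kerρ : ∀ i q → Kerρ ((M' ⊗ (M' ᴴ ⊗ Φ)) i q)
M'M'ᴴΦ∈Kerρ = from-yes (all? λ i → all? λ q → + 49 ∣? ρ ((M' ⊗ (M' ᴴ ⊗ Φ)) i q))

28e₀≉0 : ¬ JacEq M' (28E ·V [ zero ↦ 1E ]) 0⃗
28e₀≉0 28e₀≈0 = from-no (+ 49 ∣? ρ ((((28E ·V [ zero ↦ 1E ]) -V 0⃗) ⊙ (M' ᴴ ⊗ Φ)) zero))
  (Kerρ-on-Jac M' M'-rightInverse M'-rightInverse-correct Φ M'M'ᴴΦ∈Kerρ 28e₀≈0 zero)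

¬JacIso : ¬ JacIso M M'
¬JacIso iso = 28e₀≉0 (JacIso-preserves-annihilator iso 28E 28-annihilates-Jac-M [ zero ↦ 1E ])

proposition3p15 : Σ ℕ λ n → Σ ℕ λ m → Σ ℕ λ m' →
    Σ (Matrix m n) λ M → Σ (Matrix m' n) λ M' →
      IsHMatrix M × IsHMatrix M' × SameMatroid M M' × ¬ JacIso M M'
proposition3p15 = 14 , 3 , 3 , M , M' , M-isH , M'-isH , M≈M' , ¬JacIso
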